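{- For all integers $\ell \geq 2$, $m \geq 1$, $k \geq 1$, Duplicator has a winning strategy in the Ehrenfeucht–Fraïssé game with $\ell - 1$ rounds on the graphs $G^m_{\ell,k}$ and $G^m_{\ell-1,k}$.
   Context: For positive integers $L, k, m$, the almost multipartite graph $G^m_{L,k}$ has vertex set $\{(i,j,h) : 1 \le i \le L,\ 1 \le j \le k,\ 1 \le h \le m\}$, and two vertices are adjacent iff either they are of the form $(i_1,j_1,h),(i_2,j_2,h)$ with $i_1 \ne i_2$ and $j_1 \ne j_2$, or they are of the form $(i,j_1,h_1),(i,j_2,h_2)$ with $h_1 \ne h_2$. The Ehrenfeucht–Fraïssé game with $r$ rounds on graphs $G, H$: in each round Spoiler chooses a vertex in one of the graphs, different from previously chosen vertices in that graph, and then Duplicator must choose a not-yet-chosen vertex in the other graph (if he cannot, he loses). After $r$ rounds with chosen vertices $x_1,\ldots,x_r$ in $G$ and $y_1,\ldots,y_r$ in $H$ (where $x_t,y_t$ are chosen in round $t$), Duplicator wins iff the map $x_t \mapsto y_t$ is an isomorphism between the subgraphs induced on $\{x_1,\ldots,x_r\}$ and $\{y_1,\ldots,y_r\}$, i.e. $x_s \sim x_t \iff y_s \sim y_t$ for all $s,t$. -}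

module Defs where

open import Data.Nat using (ℕ; zero; suc)
open import Data.Fin using (Fin)
open import Data.Product using (Σ; _×_; _,_; proj₁; proj₂)
open import Data.Sum using (_⊎_)
open import Data.List using (List; []; _∷_; map)
open import Data.List.Membership.Propositional using (_∈_; _∉_)
open import Relation.Binary.PropositionalEquality using (_≡_; _≢_)
open import Function.Bundles using (_⇔_)

record Graph : Set₁ where
  field
    V   : Set
    Adj : V → V → Set
open Graph public

-- The almost multipartite graph G^m_{L,k}; vertex (i,j,h) with
-- i ∈ Fin L, j ∈ Fin k, h ∈ Fin m (0-based instead of 1-based indices).
AMVertex : ℕ → ℕ → ℕ → Set
AMVertex L k m = Fin L × Fin k × Fin m

AMAdj : ∀ {L k m} → AMVertex L k m → AMVertex L k m → Set
AMAdj (i₁ , j₁ , h₁) (i₂ , j₂ , h₂) =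
  (h₁ ≡ h₂ × i₁ ≢ i₂ × j₁ ≢ j₂) ⊎ (i₁ ≡ i₂ × h₁ ≢ h₂)

G : ℕ → ℕ → ℕ → Graph
G L k m = record { V = AMVertex L k m ; Adj = AMAdj }

Position : Graph → Graph → Set
Position A B = List (V A × V B)

PartialIso : (A B : Graph) → Position A B → Set
PartialIso A B pos =
  ∀ {p q} → p ∈ pos → q ∈ pos →
  Adj A (proj₁ p) (proj₁ q) ⇔ Adj B (proj₂ p) (proj₂ q)

DupWins : (A B : Graph) → ℕ → Position A B → Set
DupWins A B zero    pos = PartialIso A B pos
DupWins A B (suc r) pos =
  ((x : V A) → x ∉ map proj₁ pos →
     Σ (V B) λ y → y ∉ map proj₂ pos × DupWins A B r ((x , y) ∷ pos))
  ×
  ((y : V B) → y ∉ map proj₂ pos →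
     Σ (V A) λ x → x ∉ map proj₁ pos × DupWins A B r ((x , y) ∷ pos))

DuplicatorWinsEF : ℕ → Graph → Graph → Set
DuplicatorWinsEF r A B = DupWins A B r []

module Submission where

-- Duplicator's strategy: copy the label (j , h) of Spoiler's vertex and
-- choose the first coordinate i so that equality between first coordinates
-- is preserved.  Adjacency in G^m_{L,k} depends on first coordinates only
-- through their equality, so a position whose pairs share labels and whose
-- first coordinates have the same equality pattern on both sides ("coherent"
-- positions) is a partial isomorphism.
--
-- Induction on
-- the number of rounds gives: Duplicator wins the r-round game on
-- G^m_{a,k} and G^m_{b,k} whenever r ≤ a and r ≤ b.  Proposition 1 is the
-- instance a = ℓ, b = ℓ - 1, r = ℓ - 1.

open import Defs
open import Data.Nat using (ℕ; _≤_; _∸_; zero; suc; _+_; _<_)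
open import Data.Nat.Properties using (+-suc; m+n≤o⇒m≤o; n≤1+n; ≤-refl; <⇒≢)
open import Data.Fin using (Fin; toℕ; _≟_)
open import Data.Fin.Properties using (¬∀⟶∃¬; pigeonhole)
open import Data.Product using (_×_; _,_; proj₁; proj₂; ∃; swap)
open import Data.Sum using (inj₁; inj₂)
open import Data.List using (List; []; _∷_; map; length; lookup)
open import Data.List.Properties using (length-map; map-∘)
open import Data.List.Membership.Propositional using (_∈_; _∉_; find; lose)
open import Data.List.Membership.Propositional.Properties using (∈-map⁺; ∈-map⁻)
open import Data.List.Relation.Unary.Any using (here; there; any?; index)
open import Data.List.Relation.Unary.Any.Properties using (lookup-index)
open import Data.Empty using (⊥-elim)
open import Relation.Nullary using (¬_; yes; no)
open import Relation.Binary.PropositionalEquality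
open import Function using (_∘_)
open import Function.Bundles using (_⇔_; mk⇔; Equivalence)
open import Function.Construct.Symmetry using (⇔-sym)

open Equivalence

-- A list with fewer than n entries misses some element of Fin n: otherwise
-- the position of each element in the list would inject Fin n into a
-- smaller Fin, contradicting the pigeonhole principle.
missing : ∀ {n} (xs : List (Fin n)) → length xs < n → ∃ λ i → i ∉ xs
missing {n} xs short = ¬∀⟶∃¬ n (_∈ xs) (λ i → any? (i ≟_) xs) notAll
  where
  notAll : ¬ (∀ i → i ∈ xs)
  notAll all with pigeonhole short (λ i → index (all i))
  ... | i , j , i<j , sameIndex = <⇒≢ i<j (cong toℕ (begin
    i                         ≡⟨ lookup-index (all i) ⟩
    lookup xs (index (all i)) ≡⟨ cong (lookup xs) sameIndex ⟩
    lookup xs (index (all j)) ≡⟨ lookup-index (all j) ⟨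
    j                         ∎))
    where open ≡-Reasoning

≡-sym-⇔ : ∀ {A B : Set} {x y : A} {u v : B} → (x ≡ y ⇔ u ≡ v) → (y ≡ x ⇔ v ≡ u)
≡-sym-⇔ e = mk⇔ (λ q → sym (to e (sym q))) (λ q → sym (from e (sym q)))

module Strategy (k m : ℕ) where

  Label : Set
  Label = Fin k × Fin m

  Vertex : ℕ → Set
  Vertex a = Fin a × Label

  Pos : ℕ → ℕ → Set
  Pos a b = Position (G a k m) (G b k m)

  indexˡ : ∀ {a b} → Vertex a × Vertex b → Fin a
  indexˡ = proj₁ ∘ proj₁

  indexʳ : ∀ {a b} → Vertex a × Vertex b → Fin b
  indexʳ = proj₁ ∘ proj₂

  adj-transfer : ∀ {a b} {i₁ i₂ : Fin a} {i₁′ i₂′ : Fin b} (l₁ l₂ : Label) →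
    (i₁ ≡ i₂ ⇔ i₁′ ≡ i₂′) →
    AMAdj {a} (i₁ , l₁) (i₂ , l₂) → AMAdj {b} (i₁′ , l₁) (i₂′ , l₂)
  adj-transfer _ _ e (inj₁ (sameLayer , i≢ , j≢)) = inj₁ (sameLayer , i≢ ∘ from e , j≢)
  adj-transfer _ _ e (inj₂ (i≡ , h≢))             = inj₂ (to e i≡ , h≢)

  adj-transfer-⇔ : ∀ {a b} {i₁ i₂ : Fin a} {i₁′ i₂′ : Fin b} (l₁ l₂ : Label) →
    (i₁ ≡ i₂ ⇔ i₁′ ≡ i₂′) →
    AMAdj {a} (i₁ , l₁) (i₂ , l₂) ⇔ AMAdj {b} (i₁′ , l₁) (i₂′ , l₂)
  adj-transfer-⇔ l₁ l₂ e = mk⇔ (adj-transfer l₁ l₂ e) (adj-transfer l₁ l₂ (⇔-sym e))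

  Consistent : ∀ {a b} → Fin a → Fin b → Pos a b → Set
  Consistent i i′ pos = ∀ {q} → q ∈ pos → (i ≡ indexˡ q) ⇔ (i′ ≡ indexʳ q)

  record Coherent {a b} (pos : Pos a b) : Set where
    field
      sameLabel  : ∀ {p} → p ∈ pos → proj₂ (proj₁ p) ≡ proj₂ (proj₂ p)
      sameIndices : ∀ {p} → p ∈ pos → Consistent (indexˡ p) (indexʳ p) pos
  open Coherent

  coherent-[] : ∀ {a b} → Coherent {a} {b} []
  coherent-[] = record { sameLabel = λ () ; sameIndices = λ () }

  coherent⇒partialIso : ∀ {a b} {pos : Pos a b} → Coherent pos →
    PartialIso (G a k m) (G b k m) pos
  coherent⇒partialIso c {(_ , l₁) , (_ , l₁′)} {(_ , l₂) , (_ , l₂′)} p∈ q∈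
    with sameLabel c p∈ | sameLabel c q∈
  ... | refl | refl = adj-transfer-⇔ l₁ l₂ (sameIndices c p∈ q∈)

  extend : ∀ {a b} {pos : Pos a b} {i i′ l} → Coherent pos → Consistent i i′ pos →
    Coherent (((i , l) , (i′ , l)) ∷ pos)
  extend {pos = pos} {i} {i′} {l} c con = record { sameLabel = label ; sameIndices = indices }
    where
    new : Pos _ _
    new = ((i , l) , (i′ , l)) ∷ pos

    label : ∀ {p} → p ∈ new → proj₂ (proj₁ p) ≡ proj₂ (proj₂ p)
    label (here refl) = refl
    label (there p∈)  = sameLabel c p∈

    indices : ∀ {p} → p ∈ new → Consistent (indexˡ p) (indexʳ p) new
    indices (here refl) (here refl) = mk⇔ (λ _ → refl) (λ _ → refl)
    indices (here refl) (there q∈)  = con q∈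
    indices (there p∈)  (here refl) = ≡-sym-⇔ (con p∈)
    indices (there p∈)  (there q∈)  = sameIndices c p∈ q∈

  -- Such a pair is a legal answer: if the left vertex is fresh, so is the
  -- right one, since a repeated right vertex would force a repeated left one.
  fresh : ∀ {a b} {pos : Pos a b} {i i′ l} → Coherent pos → Consistent i i′ pos →
    (i , l) ∉ map proj₁ pos → (i′ , l) ∉ map proj₂ pos
  fresh {pos = pos} {i} {i′} {l} c con x∉ y∈ with ∈-map⁻ proj₂ y∈
  ... | q , q∈ , y≡ = x∉ (subst (_∈ map proj₁ pos) (sym x≡) (∈-map⁺ proj₁ q∈))
    where
    x≡ : (i , l) ≡ proj₁ q
    x≡ = cong₂ _,_ (from (con q∈) (cong proj₁ y≡))
                   (trans (cong proj₂ y≡) (sym (sameLabel c q∈)))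

  -- Every first coordinate on the left has a consistent partner on the right,
  -- provided the position does not yet use all first coordinates on the
  -- right: reuse the partner of an earlier occurrence, or else pick an
  -- unused one.
  matchIndex : ∀ {a b} {pos : Pos a b} → Coherent pos → length pos < b →
    (i : Fin a) → ∃ λ i′ → Consistent i i′ pos
  matchIndex {pos = pos} c short i with any? (λ p → indexˡ p ≟ i) pos
  ... | yes occurs with find occurs
  ...   | p , p∈ , p≡i = indexʳ p , λ {q} q∈ →
          subst (λ z → (z ≡ indexˡ q) ⇔ (indexʳ p ≡ indexʳ q)) p≡i (sameIndices c p∈ q∈)
  matchIndex {b = b} {pos = pos} c short i | no new
    with missing (map indexʳ pos) (subst (_< b) (sym (length-map indexʳ pos)) short)
  ... | i′ , unused = i′ , λ q∈ → mk⇔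
          (λ i≡ → ⊥-elim (new (lose q∈ (sym i≡))))
          (λ i′≡ → ⊥-elim (unused (subst (_∈ _) (sym i′≡) (∈-map⁺ indexʳ q∈))))

  answerˡ : ∀ {a b} {pos : Pos a b} → Coherent pos → length pos < b →
    (x : Vertex a) → x ∉ map proj₁ pos →
    ∃ λ (y : Vertex b) → y ∉ map proj₂ pos × Coherent ((x , y) ∷ pos)
  answerˡ c short (i , l) x∉ with matchIndex c short i
  ... | i′ , con = (i′ , l) , fresh c con x∉ , extend c con

  coherent-swap : ∀ {a b} {pos : Pos a b} → Coherent pos → Coherent (map swap pos)
  coherent-swap c = record
    { sameLabel = λ p∈ → case-swap p∈ λ q∈ → sym (sameLabel c q∈)
    ; sameIndices = λ p∈ q∈ → case-swap p∈ λ p∈′ → case-swap q∈ λ q∈′ →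
        ⇔-sym (sameIndices c p∈′ q∈′)
    }
    where
    case-swap : ∀ {A B : Set} {xs : List (A × B)} {P : B × A → Set} {p} →
      p ∈ map swap xs → (∀ {q} → q ∈ xs → P (swap q)) → P p
    case-swap p∈ f with ∈-map⁻ swap p∈
    ... | _ , q∈ , refl = f q∈

  coherent-unswap : ∀ {a b} {pos : Pos a b} → Coherent (map swap pos) → Coherent pos
  coherent-unswap c = record
    { sameLabel = λ p∈ → sym (sameLabel c (∈-map⁺ swap p∈))
    ; sameIndices = λ p∈ q∈ → ⇔-sym (sameIndices c (∈-map⁺ swap p∈) (∈-map⁺ swap q∈))
    }

  answerʳ : ∀ {a b} {pos : Pos a b} → Coherent pos → length pos < a →
    (y : Vertex b) → y ∉ map proj₂ pos →
    ∃ λ (x : Vertex a) → x ∉ map proj₁ pos × Coherent ((x , y) ∷ pos)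
  answerʳ {a} {pos = pos} c short y y∉
    with answerˡ (coherent-swap c) (subst (_< a) (sym (length-map swap pos)) short)
                 y (subst (y ∉_) (map-∘ pos) y∉)
  ... | x , x∉ , c′ = x , subst (x ∉_) (sym (map-∘ pos)) x∉ , coherent-unswap c′

  duplicatorWins : ∀ {a b} r (pos : Pos a b) → Coherent pos →
    length pos + r ≤ a → length pos + r ≤ b → DupWins (G a k m) (G b k m) r pos
  duplicatorWins zero    pos c _ _ = coherent⇒partialIso c
  duplicatorWins (suc r) pos c roomᵃ roomᵇ =
    (λ x x∉ → let (y , y∉ , c′) = answerˡ c (short (afterMove roomᵇ)) x x∉
              in y , y∉ , duplicatorWins r _ c′ (afterMove roomᵃ) (afterMove roomᵇ)) ,
    (λ y y∉ → let (x , x∉ , c′) = answerʳ c (short (afterMove roomᵃ)) y y∉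
              in x , x∉ , duplicatorWins r _ c′ (afterMove roomᵃ) (afterMove roomᵇ))
    where
    afterMove : ∀ {n} → length pos + suc r ≤ n → suc (length pos + r) ≤ n
    afterMove {n} = subst (_≤ n) (+-suc (length pos) r)

    short : ∀ {n} → suc (length pos + r) ≤ n → length pos < n
    short = m+n≤o⇒m≤o (suc (length pos))

  duplicatorWinsEF : ∀ {a b} r → r ≤ a → r ≤ b → DuplicatorWinsEF r (G a k m) (G b k m)
  duplicatorWinsEF r = duplicatorWins r [] coherent-[]

-- Proposition 1: the instance a = ℓ, b = r = ℓ - 1.
proposition1 : (ℓ m k : ℕ) → 2 ≤ ℓ → 1 ≤ m → 1 ≤ k →
    DuplicatorWinsEF (ℓ ∸ 1) (G ℓ k m) (G (ℓ ∸ 1) k m)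
proposition1 (suc ℓ′) m k _ _ _ = Strategy.duplicatorWinsEF k m ℓ′ (n≤1+n ℓ′) ≤-refl
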